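{- Let $a_1,a_2,a_3,a_4,p_1,p_2,p_3,p_4,x_1,x_2,x_3,x_4,q_1,q_2,q_3,q_4$ be nonzero complex numbers. Put $L:=(p_1p_2p_3p_4)^{1/2}$, $L_0:=(q_1q_2q_3q_4)^{1/2}$, $X:=a_4/a_3$, $Y:=x_4/x_3$. For an integer $k\ge -1$ define $$E_k[\bar x;\bar q]:=\big(x_1(q_1q_3)^{k/2}-x_2x_4(q_2q_4)^{k/2}/x_3\big)\big(x_1(q_1q_4)^{k/2}-x_2x_3(q_2q_3)^{k/2}/x_4\big),$$ and $E_k[\bar a;\bar p]$ by the same formula with every $x_i$ replaced by $a_i$ and every $q_i$ by $p_i$. Then for every integer $n\ge 0$ (whenever no denominator vanishes) $$\sum_{k=0}^{n-1}\frac{E_{k-1}[\bar a;\bar p]}{(p_3p_4)^{(k-1)/2}}\frac{(a_1^2/p_1;p_1)_k(a_2^2/p_2;p_2)_k}{(a_1a_2p_3X/L;L/p_3)_{k+1}(a_1a_2p_4/(LX);L/p_4)_{k+1}}\cdot\frac{(x_1^2;q_1)_k(x_2^2;q_2)_k}{(x_1x_2Y;L_0/q_3)_k(x_1x_2/Y;L_0/q_4)_k}$$ $$=1-\frac{(a_1^2/p_1;p_1)_n(a_2^2/p_2;p_2)_n(x_1^2;q_1)_n(x_2^2;q_2)_n}{(a_1a_2p_3X/L;L/p_3)_n(a_1a_2p_4/(LX);L/p_4)_n(x_1x_2Y;L_0/q_3)_n(x_1x_2/Y;L_0/q_4)_n}$$ $$-\sum_{k=0}^{n-1}\frac{E_k[\bar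 x;\bar q]}{(q_3q_4)^{k/2}}\frac{(a_1^2/p_1;p_1)_{k+1}(a_2^2/p_2;p_2)_{k+1}}{(a_1a_2p_3X/L;L/p_3)_{k+1}(a_1a_2p_4/(LX);L/p_4)_{k+1}}\cdot\frac{(x_1^2;q_1)_k(x_2^2;q_2)_k}{(x_1x_2Y;L_0/q_3)_{k+1}(x_1x_2/Y;L_0/q_4)_{k+1}}.$$
   Context: For a complex number $z$, a nonzero complex base $p$ and an integer $k\ge0$, $(z;p)_k:=\prod_{j=0}^{k-1}(1-zp^j)$ (so $(z;p)_0=1$). Square roots $p_i^{1/2},q_i^{1/2}$ are fixed once and for all, and every half-integer power of a product of the $p_i$ (resp. $q_i$) is understood as the corresponding product of powers of these fixed roots, e.g. $(q_1q_3)^{k/2}=(q_1^{1/2}q_3^{1/2})^k$ and $L=p_1^{1/2}p_2^{1/2}p_3^{1/2}p_4^{1/2}$. -}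

module Defs where

open import Level using (Level; _⊔_) renaming (suc to lsuc)
open import Algebra.Bundles using (CommutativeRing)
open import Data.Nat using (ℕ; zero; suc)
open import Data.Integer using (ℤ; +_; -[1+_])
open import Relation.Nullary using (¬_)

-- A field: a commutative ring with 1 ≠ 0 and a (total, congruent)
-- inversion operation which is a two-sided inverse on nonzero elements.
-- (The value of 0⁻¹ is irrelevant: it never occurs under the hypotheses.)
record Field (c ℓ : Level) : Set (lsuc (c ⊔ ℓ)) where
  field
    commutativeRing : CommutativeRing c ℓ
  open CommutativeRing commutativeRing public
  infix 8 _⁻¹
  field
    _⁻¹      : Carrier → Carrier
    ⁻¹-cong  : ∀ {x y} → x ≈ y → x ⁻¹ ≈ y ⁻¹
    1≉0      : ¬ (1# ≈ 0#)
    inverseʳ : ∀ x → ¬ (x ≈ 0#) → x * x ⁻¹ ≈ 1#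

module FieldOps {c ℓ : Level} (F : Field c ℓ) where
  open Field F

  infixl 7 _/_
  _/_ : Carrier → Carrier → Carrier
  x / y = x * y ⁻¹

  pow : Carrier → ℕ → Carrier
  pow x zero    = 1#
  pow x (suc n) = pow x n * x

  zpow : Carrier → ℤ → Carrier
  zpow x (+ n)      = pow x n
  zpow x -[1+ n ]   = (pow x (suc n)) ⁻¹

  poch : Carrier → Carrier → ℕ → Carrier
  poch z p zero    = 1#
  poch z p (suc k) = poch z p k * (1# - z * pow p k)

  sumTo : (ℕ → Carrier) → ℕ → Carrier
  sumTo f zero    = 0#
  sumTo f (suc n) = sumTo f n + f n

  -- E_k[x̄; q̄], where s1..s4 are the fixed square roots of q1..q4,
  -- so that (q_i q_j)^{k/2} = (s_i s_j)^k.
  E : ℤ → (x1 x2 x3 x4 s1 s2 s3 s4 : Carrier) → Carrier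
  E k x1 x2 x3 x4 s1 s2 s3 s4 =
    (x1 * zpow (s1 * s3) k - x2 * x4 * zpow (s2 * s4) k / x3)
    * (x1 * zpow (s1 * s4) k - x2 * x3 * zpow (s2 * s3) k / x4)

{-# OPTIONS --safe #-}
module Submission where

-- Let ρ k be the Pochhammer quotient subtracted on the right, so ρ 0 = 1.
-- Divided by the appropriate power of s₃s₄, E is (a - b g)(a - b g⁻¹) with
-- a = x₁s₁ᵏ, b = x₂s₂ᵏ, g = Y (s₄/s₃)ᵏ, and this equals
-- (1 - abg)(1 - ab/g) - (1 - a²)(1 - b²). The four brackets are exactly the
-- factors by which the denominator and numerator Pochhammer symbols grow from
-- k to k + 1. On the ā side the Pochhammer bases a₁a₂p₃X/L, …, a₁²/p₁, … carry
-- one inverse power of the ratio, which is why E[ā;p̄] enters with index k - 1.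
-- Hence the k-th terms of the two sums add up to ρ k - ρ (k + 1), and the
-- identity telescopes.

open import Defs
open import Level using (Level)
open import Data.Nat using (ℕ; suc)
open import Data.Integer using (+_)
open import Relation.Nullary using (¬_)
import Data.Integer as ℤ

open import Algebra.Bundles using (CommutativeRing)
import Data.Maybe as Maybe
open import Relation.Nullary.Decidable using (dec⇒maybe)
open import Relation.Binary.Definitions using (WeaklyDecidable)
open import Data.Nat as ℕ using (zero; _<_; _≤′_; ≤′-refl; ≤′-step)
import Data.Nat.Properties as ℕ
open import Data.Integer using (ℤ; -[1+_]; ∣_∣; sign)
import Data.Integer.Properties as ℤ
open import Data.Sign as Sign using (Sign)
import Relation.Binary.PropositionalEquality as ≡
open import Algebra.Solver.Ring.AlmostCommutativeRing
  using (_-Raw-AlmostCommutative⟶_; fromCommutativeRing; Induced-equivalence)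

-- Algebra.Solver.Ring with integer coefficients: Algebra.Solver.Ring.Simple would
-- need decidable equality on the carrier, whereas here vanishing coefficients are
-- detected in ℤ. The optimised _×_ makes ⟦ + 1 ⟧ℤ reduce to 1#, as the solver's
-- refl proofs require.
module IntegerCoefficientSolver {c ℓ : Level} (R : CommutativeRing c ℓ) where
  open CommutativeRing R
  open import Algebra.Properties.Semiring.Mult.TCOptimised semiring
    using (_×_; 1+×; ×-homo-+; ×1-homo-*)
  open import Algebra.Properties.Ring ring using (-1*x≈-x)
  open import Algebra.Properties.AbelianGroup +-abelianGroup using (⁻¹-∙-comm)
  open import Algebra.Properties.Group +-group using (ε⁻¹≈ε; ⁻¹-involutive)
  open import Algebra.Properties.CommutativeSemigroup *-commutativeSemigroup
    using (interchange)
  open import Algebra.Properties.CommutativeSemigroup +-commutativeSemigroup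
    using () renaming (interchange to +-interchange)
  open import Relation.Binary.Reasoning.Setoid setoid

  ⟦_⟧ℤ : ℤ → Carrier
  ⟦ + n ⟧ℤ      = n × 1#
  ⟦ -[1+ n ] ⟧ℤ = - (suc n × 1#)

  ⟦_⟧ₛ : Sign → Carrier
  ⟦ Sign.+ ⟧ₛ = 1#
  ⟦ Sign.- ⟧ₛ = - 1#

  ⟦◃⟧ : ∀ s n → ⟦ s ℤ.◃ n ⟧ℤ ≈ ⟦ s ⟧ₛ * (n × 1#)
  ⟦◃⟧ s       zero    = sym (zeroʳ _)
  ⟦◃⟧ Sign.+ (suc n) = sym (*-identityˡ _)
  ⟦◃⟧ Sign.- (suc n) = sym (-1*x≈-x _)

  sign-abs : ∀ i → ⟦ i ⟧ℤ ≈ ⟦ sign i ⟧ₛ * (∣ i ∣ × 1#)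
  sign-abs i = begin
    ⟦ i ⟧ℤ                   ≡⟨ ≡.cong ⟦_⟧ℤ (≡.sym (ℤ.◃-inverse i)) ⟩
    ⟦ sign i ℤ.◃ ∣ i ∣ ⟧ℤ    ≈⟨ ⟦◃⟧ (sign i) ∣ i ∣ ⟩
    ⟦ sign i ⟧ₛ * (∣ i ∣ × 1#) ∎

  ⟦*⟧ₛ : ∀ s t → ⟦ s Sign.* t ⟧ₛ ≈ ⟦ s ⟧ₛ * ⟦ t ⟧ₛ
  ⟦*⟧ₛ Sign.+ t      = sym (*-identityˡ _)
  ⟦*⟧ₛ Sign.- Sign.+ = sym (*-identityʳ _)
  ⟦*⟧ₛ Sign.- Sign.- = sym (trans (-1*x≈-x _) (⁻¹-involutive _))

  *-homo : ∀ i j → ⟦ i ℤ.* j ⟧ℤ ≈ ⟦ i ⟧ℤ * ⟦ j ⟧ℤ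
  *-homo i j = begin
    ⟦ sign i Sign.* sign j ℤ.◃ ∣ i ∣ ℕ.* ∣ j ∣ ⟧ℤ
      ≈⟨ ⟦◃⟧ (sign i Sign.* sign j) (∣ i ∣ ℕ.* ∣ j ∣) ⟩
    ⟦ sign i Sign.* sign j ⟧ₛ * ((∣ i ∣ ℕ.* ∣ j ∣) × 1#)
      ≈⟨ *-cong (⟦*⟧ₛ (sign i) (sign j)) (×1-homo-* ∣ i ∣ ∣ j ∣) ⟩
    ⟦ sign i ⟧ₛ * ⟦ sign j ⟧ₛ * ((∣ i ∣ × 1#) * (∣ j ∣ × 1#))
      ≈⟨ interchange _ _ _ _ ⟩
    ⟦ sign i ⟧ₛ * (∣ i ∣ × 1#) * (⟦ sign j ⟧ₛ * (∣ j ∣ × 1#))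
      ≈⟨ *-cong (sym (sign-abs i)) (sym (sign-abs j)) ⟩
    ⟦ i ⟧ℤ * ⟦ j ⟧ℤ ∎

  -‿homo : ∀ i → ⟦ ℤ.- i ⟧ℤ ≈ - ⟦ i ⟧ℤ
  -‿homo (+ zero)  = sym ε⁻¹≈ε
  -‿homo (+ suc n) = refl
  -‿homo -[1+ n ]  = sym (⁻¹-involutive _)

  ⊖-homo : ∀ m n → ⟦ m ℤ.⊖ n ⟧ℤ ≈ m × 1# - n × 1#
  ⊖-homo zero    zero    = sym (trans (+-identityˡ _) ε⁻¹≈ε)
  ⊖-homo (suc m) zero    = sym (trans (+-congˡ ε⁻¹≈ε) (+-identityʳ _))
  ⊖-homo zero    (suc n) = sym (+-identityˡ _)
  ⊖-homo (suc m) (suc n) = begin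
    ⟦ suc m ℤ.⊖ suc n ⟧ℤ          ≡⟨ ≡.cong ⟦_⟧ℤ (ℤ.[1+m]⊖[1+n]≡m⊖n m n) ⟩
    ⟦ m ℤ.⊖ n ⟧ℤ                  ≈⟨ ⊖-homo m n ⟩
    m × 1# - n × 1#               ≈⟨ sym (+-identityˡ _) ⟩
    0# + (m × 1# - n × 1#)        ≈⟨ +-congʳ (sym (-‿inverseʳ 1#)) ⟩
    (1# - 1#) + (m × 1# - n × 1#) ≈⟨ +-interchange _ _ _ _ ⟩
    (1# + m × 1#) + (- 1# - n × 1#)
      ≈⟨ +-cong (sym (1+× m 1#)) (trans (⁻¹-∙-comm _ _) (-‿cong (sym (1+× n 1#)))) ⟩
    suc m × 1# - suc n × 1#       ∎

  +-homo : ∀ i j → ⟦ i ℤ.+ j ⟧ℤ ≈ ⟦ i ⟧ℤ + ⟦ j ⟧ℤ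
  +-homo (+ m)    (+ n)    = ×-homo-+ 1# m n
  +-homo (+ m)    -[1+ n ] = ⊖-homo m (suc n)
  +-homo -[1+ m ] (+ n)    = trans (⊖-homo n (suc m)) (+-comm _ _)
  +-homo -[1+ m ] -[1+ n ] = begin
    - (suc (suc (m ℕ.+ n)) × 1#)    ≡⟨ ≡.cong (λ k → - (suc k × 1#)) (≡.sym (ℕ.+-suc m n)) ⟩
    - ((suc m ℕ.+ suc n) × 1#)      ≈⟨ -‿cong (×-homo-+ 1# (suc m) (suc n)) ⟩
    - (suc m × 1# + suc n × 1#)     ≈⟨ sym (⁻¹-∙-comm _ _) ⟩
    - (suc m × 1#) + - (suc n × 1#) ∎

  morphism : ℤ.+-*-rawRing -Raw-AlmostCommutative⟶ fromCommutativeRing R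
  morphism = record
    { ⟦_⟧ = ⟦_⟧ℤ ; +-homo = +-homo ; *-homo = *-homo ; -‿homo = -‿homo
    ; 0-homo = refl ; 1-homo = refl }

  _≟_ : WeaklyDecidable (Induced-equivalence morphism)
  i ≟ j = Maybe.map (λ i≡j → reflexive (≡.cong ⟦_⟧ℤ i≡j)) (dec⇒maybe (i ℤ.≟ j))

  open import Algebra.Solver.Ring ℤ.+-*-rawRing (fromCommutativeRing R) morphism _≟_ public
    using (solve; _:=_; _:+_; _:*_; _:-_; :-_; con)

module FieldProperties {c ℓ : Level} (F : Field c ℓ) where
  open Field F
  open FieldOps F
  open IntegerCoefficientSolver commutativeRing using (solve; _:=_; _:+_; _:*_; _:-_; :-_; con)
  open import Algebra.Properties.CommutativeSemigroup *-commutativeSemigroup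
    using (interchange; xy∙z≈xz∙y; x∙yz≈xz∙y)
  open import Algebra.Properties.CommutativeSemigroup +-commutativeSemigroup
    using () renaming (interchange to +-interchange)
  open import Relation.Binary.Reasoning.Setoid setoid

  x*u≈x : ∀ {u} x → u ≈ 1# → x * u ≈ x
  x*u≈x x u≈1 = trans (*-congˡ u≈1) (*-identityʳ x)

  x+y*[u-1]≈x : ∀ {u} x y → u ≈ 1# → x + y * (u - 1#) ≈ x
  x+y*[u-1]≈x {u} x y u≈1 = begin
    x + y * (u - 1#)  ≈⟨ +-congˡ (*-congˡ (+-congʳ u≈1)) ⟩
    x + y * (1# - 1#) ≈⟨ +-congˡ (*-congˡ (-‿inverseʳ 1#)) ⟩
    x + y * 0#        ≈⟨ +-congˡ (zeroʳ y) ⟩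
    x + 0#            ≈⟨ +-identityʳ x ⟩
    x                 ∎

  /-cong : ∀ {x x′ y y′} → x ≈ x′ → y ≈ y′ → x / y ≈ x′ / y′
  /-cong x≈x′ y≈y′ = *-cong x≈x′ (⁻¹-cong y≈y′)

  inverseˡ : ∀ {x} → x ≉ 0# → x ⁻¹ * x ≈ 1#
  inverseˡ {x} x≉0 = trans (*-comm _ x) (inverseʳ x x≉0)

  x*y≉0 : ∀ {x y} → x ≉ 0# → y ≉ 0# → x * y ≉ 0#
  x*y≉0 {x} {y} x≉0 y≉0 xy≈0 = 1≉0 (begin
    1#                      ≈⟨ sym (x*u≈x 1# (inverseʳ y y≉0)) ⟩
    1# * (y * y ⁻¹)         ≈⟨ *-congʳ (sym (inverseʳ x x≉0)) ⟩
    x * x ⁻¹ * (y * y ⁻¹)   ≈⟨ interchange x (x ⁻¹) y (y ⁻¹) ⟩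
    x * y * (x ⁻¹ * y ⁻¹)   ≈⟨ *-congʳ xy≈0 ⟩
    0# * (x ⁻¹ * y ⁻¹)      ≈⟨ zeroˡ _ ⟩
    0#                      ∎)

  x*y≉0⇒x≉0 : ∀ {x y} → x * y ≉ 0# → x ≉ 0#
  x*y≉0⇒x≉0 {y = y} xy≉0 x≈0 = xy≉0 (trans (*-congʳ x≈0) (zeroˡ y))

  x*y≉0⇒y≉0 : ∀ {x y} → x * y ≉ 0# → y ≉ 0#
  x*y≉0⇒y≉0 {x} xy≉0 y≈0 = xy≉0 (trans (*-congˡ y≈0) (zeroʳ x))

  inverse-unique : ∀ {x y} → x ≉ 0# → x * y ≈ 1# → y ≈ x ⁻¹
  inverse-unique {x} {y} x≉0 xy≈1 = begin
    y                ≈⟨ sym (x*u≈x y (inverseʳ x x≉0)) ⟩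
    y * (x * x ⁻¹)   ≈⟨ sym (*-assoc y x (x ⁻¹)) ⟩
    y * x * x ⁻¹     ≈⟨ *-congʳ (trans (*-comm y x) xy≈1) ⟩
    1# * x ⁻¹        ≈⟨ *-identityˡ _ ⟩
    x ⁻¹             ∎

  x⁻¹≉0 : ∀ {x} → x ≉ 0# → x ⁻¹ ≉ 0#
  x⁻¹≉0 {x} x≉0 x⁻¹≈0 = 1≉0 (trans (sym (inverseʳ x x≉0)) (trans (*-congˡ x⁻¹≈0) (zeroʳ x)))

  ⁻¹-involutive : ∀ {x} → x ≉ 0# → x ⁻¹ ⁻¹ ≈ x
  ⁻¹-involutive x≉0 = sym (inverse-unique (x⁻¹≉0 x≉0) (inverseˡ x≉0))

  ⁻¹-distrib-* : ∀ {x y} → x ≉ 0# → y ≉ 0# → (x * y) ⁻¹ ≈ x ⁻¹ * y ⁻¹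
  ⁻¹-distrib-* {x} {y} x≉0 y≉0 = sym (inverse-unique (x*y≉0 x≉0 y≉0) (begin
    x * y * (x ⁻¹ * y ⁻¹)   ≈⟨ interchange x y (x ⁻¹) (y ⁻¹) ⟩
    x * x ⁻¹ * (y * y ⁻¹)   ≈⟨ x*u≈x _ (inverseʳ y y≉0) ⟩
    x * x ⁻¹                ≈⟨ inverseʳ x x≉0 ⟩
    1#                      ∎))

  1⁻¹≈1 : 1# ⁻¹ ≈ 1#
  1⁻¹≈1 = sym (inverse-unique 1≉0 (*-identityˡ 1#))

  [x/y]⁻¹≈y/x : ∀ {x y} → x ≉ 0# → y ≉ 0# → (x / y) ⁻¹ ≈ y / x
  [x/y]⁻¹≈y/x {x} {y} x≉0 y≉0 = begin
    (x * y ⁻¹) ⁻¹     ≈⟨ ⁻¹-distrib-* x≉0 (x⁻¹≉0 y≉0) ⟩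
    x ⁻¹ * y ⁻¹ ⁻¹    ≈⟨ *-congˡ (⁻¹-involutive y≉0) ⟩
    x ⁻¹ * y          ≈⟨ *-comm (x ⁻¹) y ⟩
    y * x ⁻¹          ∎

  root≉0 : ∀ {r p} → r * r ≈ p → p ≉ 0# → r ≉ 0#
  root≉0 rr≈p p≉0 = x*y≉0⇒x≉0 (λ rr≈0 → p≉0 (trans (sym rr≈p) rr≈0))

  u*r/p≈u/r : ∀ {r p} u → r * r ≈ p → r ≉ 0# → u * r / p ≈ u / r
  u*r/p≈u/r {r} {p} u rr≈p r≉0 = begin
    u * r * p ⁻¹              ≈⟨ *-congˡ (⁻¹-cong (sym rr≈p)) ⟩
    u * r * (r * r) ⁻¹        ≈⟨ *-congˡ (⁻¹-distrib-* r≉0 r≉0) ⟩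
    u * r * (r ⁻¹ * r ⁻¹)
      ≈⟨ solve 3 (λ u r s → u :* r :* (s :* s) := u :* s :* (r :* s)) refl u r (r ⁻¹) ⟩
    u * r ⁻¹ * (r * r ⁻¹)     ≈⟨ x*u≈x _ (inverseʳ r r≉0) ⟩
    u * r ⁻¹                  ∎

  u*r*v/p≈u*v/r : ∀ {r p} u v → r * r ≈ p → r ≉ 0# → u * r * v / p ≈ u * v / r
  u*r*v/p≈u*v/r u v rr≈p r≉0 = trans (*-congʳ (xy∙z≈xz∙y u _ v)) (u*r/p≈u/r (u * v) rr≈p r≉0)

  pow-cong : ∀ {x y} k → x ≈ y → pow x k ≈ pow y k
  pow-cong zero    x≈y = refl
  pow-cong (suc k) x≈y = *-cong (pow-cong k x≈y) x≈y

  pow-distrib-* : ∀ x y k → pow (x * y) k ≈ pow x k * pow y k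
  pow-distrib-* x y zero    = sym (*-identityˡ 1#)
  pow-distrib-* x y (suc k) = begin
    pow (x * y) k * (x * y)          ≈⟨ *-congʳ (pow-distrib-* x y k) ⟩
    pow x k * pow y k * (x * y)      ≈⟨ interchange _ _ x y ⟩
    pow x k * x * (pow y k * y)      ∎

  pow-1# : ∀ k → pow 1# k ≈ 1#
  pow-1# zero    = refl
  pow-1# (suc k) = trans (*-identityʳ _) (pow-1# k)

  pow-≉0 : ∀ {x} k → x ≉ 0# → pow x k ≉ 0#
  pow-≉0 zero    x≉0 = 1≉0
  pow-≉0 (suc k) x≉0 = x*y≉0 (pow-≉0 k x≉0) x≉0

  pow-⁻¹ : ∀ {x} k → x ≉ 0# → pow (x ⁻¹) k ≈ pow x k ⁻¹
  pow-⁻¹ {x} k x≉0 = inverse-unique (pow-≉0 k x≉0) (begin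
    pow x k * pow (x ⁻¹) k    ≈⟨ sym (pow-distrib-* x (x ⁻¹) k) ⟩
    pow (x * x ⁻¹) k          ≈⟨ pow-cong k (inverseʳ x x≉0) ⟩
    pow 1# k                  ≈⟨ pow-1# k ⟩
    1#                        ∎)

  zpow-cong : ∀ {x y} j → x ≈ y → zpow x j ≈ zpow y j
  zpow-cong (+ n)      x≈y = pow-cong n x≈y
  zpow-cong -[1+ n ]   x≈y = ⁻¹-cong (pow-cong (suc n) x≈y)

  zpow-distrib-* : ∀ {x y} j → x ≉ 0# → y ≉ 0# → zpow (x * y) j ≈ zpow x j * zpow y j
  zpow-distrib-* {x} {y} (+ n)    x≉0 y≉0 = pow-distrib-* x y n
  zpow-distrib-* {x} {y} -[1+ n ] x≉0 y≉0 =
    trans (⁻¹-cong (pow-distrib-* x y (suc n)))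
          (⁻¹-distrib-* (pow-≉0 (suc n) x≉0) (pow-≉0 (suc n) y≉0))

  zpow-⁻¹ : ∀ {x} j → x ≉ 0# → zpow (x ⁻¹) j ≈ zpow x j ⁻¹
  zpow-⁻¹ (+ n)    x≉0 = pow-⁻¹ n x≉0
  zpow-⁻¹ -[1+ n ] x≉0 = ⁻¹-cong (pow-⁻¹ (suc n) x≉0)

  zpow-pred : ∀ {x} k → x ≉ 0# → zpow x (+ k ℤ.- + 1) * x ≈ pow x k
  zpow-pred zero    x≉0 = trans (*-congʳ (⁻¹-cong (*-identityˡ _))) (inverseˡ x≉0)
  zpow-pred (suc k) x≉0 = refl

  pow-shift : ∀ {c d x y} k → x ≉ 0# → c * x ≈ d → x ≈ y →
              c * pow x k ≈ d * zpow y (+ k ℤ.- + 1)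
  pow-shift {c} {d} {x} {y} k x≉0 cx≈d x≈y = begin
    c * pow x k                        ≈⟨ *-congˡ (sym (zpow-pred k x≉0)) ⟩
    c * (zpow x (+ k ℤ.- + 1) * x)     ≈⟨ x∙yz≈xz∙y c _ x ⟩
    c * x * zpow x (+ k ℤ.- + 1)       ≈⟨ *-cong cx≈d (zpow-cong (+ k ℤ.- + 1) x≈y) ⟩
    d * zpow y (+ k ℤ.- + 1)           ∎

  zpow-quotient : ∀ {u v w z} j → u ≉ 0# → v ≉ 0# → w ≉ 0# → z ≉ 0# →
    zpow (u * v * w / z) j ≈ zpow u j * zpow v j * zpow w j / zpow z j
  zpow-quotient {u} {v} {w} {z} j u≉0 v≉0 w≉0 z≉0 = begin
    zpow (u * v * w * z ⁻¹) j
      ≈⟨ zpow-distrib-* j (x*y≉0 uv≉0 w≉0) (x⁻¹≉0 z≉0) ⟩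
    zpow (u * v * w) j * zpow (z ⁻¹) j
      ≈⟨ *-cong (zpow-distrib-* j uv≉0 w≉0) (zpow-⁻¹ j z≉0) ⟩
    zpow (u * v) j * zpow w j * zpow z j ⁻¹
      ≈⟨ *-congʳ (*-congʳ (zpow-distrib-* j u≉0 v≉0)) ⟩
    zpow u j * zpow v j * zpow w j * zpow z j ⁻¹ ∎
    where uv≉0 = x*y≉0 u≉0 v≉0

  x/y*[y/x]≈1 : ∀ {x y} → x ≉ 0# → y ≉ 0# → x / y * (y / x) ≈ 1#
  x/y*[y/x]≈1 x≉0 y≉0 =
    trans (*-congˡ (sym ([x/y]⁻¹≈y/x x≉0 y≉0))) (inverseʳ _ (x*y≉0 x≉0 (x⁻¹≉0 y≉0)))

  Δ : Carrier → Carrier → Carrier → Carrier → Carrier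
  Δ u v w z = (1# - u) * (1# - v) - (1# - w) * (1# - z)

  Δ-cong : ∀ {u u′ v v′ w w′ z z′} → u ≈ u′ → v ≈ v′ → w ≈ w′ → z ≈ z′ →
           Δ u v w z ≈ Δ u′ v′ w′ z′
  Δ-cong u≈ v≈ w≈ z≈ = +-cong (*-cong (+-congˡ (-‿cong u≈)) (+-congˡ (-‿cong v≈)))
                              (-‿cong (*-cong (+-congˡ (-‿cong w≈)) (+-congˡ (-‿cong z≈))))

  -- Both sides equal a² + b² - ab(g + h) up to a multiple of gh - 1.
  difference-of-products : ∀ a b g h → g * h ≈ 1# →
    (a - b * g) * (a - b * h) ≈ Δ (a * b * g) (a * b * h) (a * a) (b * b)
  difference-of-products a b g h gh≈1 = trans
    (solve 4 (λ a b g h →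
        (a :- b :* g) :* (a :- b :* h)
      := (con (+ 1) :- a :* b :* g) :* (con (+ 1) :- a :* b :* h)
           :- (con (+ 1) :- a :* a) :* (con (+ 1) :- b :* b)
        :+ (b :* b :- a :* a :* (b :* b)) :* (g :* h :- con (+ 1))) refl a b g h)
    (x+y*[u-1]≈x _ _ gh≈1)

  factor-out : ∀ {G} x1 x2 G1 G2 y z H → G ≉ 0# →
    x1 * (G1 * G) - x2 * y * (G2 * H) / z ≈ (x1 * G1 - x2 * G2 * (y / z * (H / G))) * G
  factor-out {G} x1 x2 G1 G2 y z H G≉0 = sym (trans
    (solve 9 (λ x1 x2 G1 G2 y zi H G Gi →
        (x1 :* G1 :- x2 :* G2 :* (y :* zi :* (H :* Gi))) :* G
      := x1 :* (G1 :* G) :- x2 :* y :* (G2 :* H) :* zi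
           :+ (:- (x2 :* y :* (G2 :* H) :* zi)) :* (Gi :* G :- con (+ 1)))
      refl x1 x2 G1 G2 y (z ⁻¹) H G (G ⁻¹))
    (x+y*[u-1]≈x _ _ (inverseˡ G≉0)))

  zpow-≉0 : ∀ {x} j → x ≉ 0# → zpow x j ≉ 0#
  zpow-≉0 (+ n)    x≉0 = pow-≉0 n x≉0
  zpow-≉0 -[1+ n ] x≉0 = x⁻¹≉0 (pow-≉0 (suc n) x≉0)

  E-factorisation : ∀ j x1 x2 x3 x4 s1 s2 s3 s4 →
    x3 ≉ 0# → x4 ≉ 0# → s1 ≉ 0# → s2 ≉ 0# → s3 ≉ 0# → s4 ≉ 0# →
    E j x1 x2 x3 x4 s1 s2 s3 s4 / zpow (s3 * s4) j
    ≈ Δ (x1 * x2 * (x4 / x3) * zpow (s1 * s2 * s4 / s3) j)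
        (x1 * x2 * (x3 / x4) * zpow (s1 * s2 * s3 / s4) j)
        (x1 * x1 * zpow (s1 * s1) j) (x2 * x2 * zpow (s2 * s2) j)
  E-factorisation j x1 x2 x3 x4 s1 s2 s3 s4 x3≉0 x4≉0 s1≉0 s2≉0 s3≉0 s4≉0 = begin
    E j x1 x2 x3 x4 s1 s2 s3 s4 / zpow (s3 * s4) j
      ≈⟨ *-cong (*-cong (factor x4 x3 s3≉0 s4≉0) (factor x3 x4 s4≉0 s3≉0))
                (⁻¹-cong (zpow-distrib-* j s3≉0 s4≉0)) ⟩
    (a - b * g) * G3 * ((a - b * h) * G4) * (G3 * G4) ⁻¹
      ≈⟨ *-congʳ (interchange _ G3 _ G4) ⟩
    (a - b * g) * (a - b * h) * (G3 * G4) * (G3 * G4) ⁻¹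
      ≈⟨ trans (*-assoc _ _ _) (x*u≈x _ (inverseʳ _ (x*y≉0 G3≉0 G4≉0))) ⟩
    (a - b * g) * (a - b * h)
      ≈⟨ difference-of-products a b g h gh≈1 ⟩
    Δ (a * b * g) (a * b * h) (a * a) (b * b)
      ≈⟨ Δ-cong (monomial x4 x3 (zpow-quotient j s1≉0 s2≉0 s4≉0 s3≉0))
                (monomial x3 x4 (zpow-quotient j s1≉0 s2≉0 s3≉0 s4≉0))
                (square x1 s1≉0) (square x2 s2≉0) ⟩
    _ ∎
    where
    G1 = zpow s1 j
    G2 = zpow s2 j
    G3 = zpow s3 j
    G4 = zpow s4 j
    a = x1 * G1
    b = x2 * G2
    g = x4 / x3 * (G4 / G3)
    h = x3 / x4 * (G3 / G4)
    G3≉0 = zpow-≉0 j s3≉0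
    G4≉0 = zpow-≉0 j s4≉0

    gh≈1 : g * h ≈ 1#
    gh≈1 = trans (interchange _ _ _ _)
                 (trans (*-cong (x/y*[y/x]≈1 x4≉0 x3≉0) (x/y*[y/x]≈1 G4≉0 G3≉0)) (*-identityˡ 1#))

    factor : ∀ {u w} y z → u ≉ 0# → w ≉ 0# →
      x1 * zpow (s1 * u) j - x2 * y * zpow (s2 * w) j / z
      ≈ (a - b * (y / z * (zpow w j / zpow u j))) * zpow u j
    factor y z u≉0 w≉0 = trans
      (+-cong (*-congˡ (zpow-distrib-* j s1≉0 u≉0))
              (-‿cong (*-congʳ (*-congˡ (zpow-distrib-* j s2≉0 w≉0)))))
      (factor-out x1 x2 G1 G2 y z _ (zpow-≉0 j u≉0))

    monomial : ∀ {H G q} y z → q ≈ G1 * G2 * H / G →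
      a * b * (y / z * (H / G)) ≈ x1 * x2 * (y / z) * q
    monomial {H} {G} y z q≈ = trans
      (solve 7 (λ x1 G1 x2 G2 yz H Gi →
          x1 :* G1 :* (x2 :* G2) :* (yz :* (H :* Gi)) := x1 :* x2 :* yz :* (G1 :* G2 :* H :* Gi))
        refl x1 G1 x2 G2 (y / z) H (G ⁻¹))
      (*-congˡ (sym q≈))

    square : ∀ {s} x → s ≉ 0# → x * zpow s j * (x * zpow s j) ≈ x * x * zpow (s * s) j
    square x s≉0 = trans (interchange _ _ _ _) (*-congˡ (sym (zpow-distrib-* j s≉0 s≉0)))

  E-factorisation-ℕ : ∀ x1 x2 x3 x4 q1 q2 q3 q4 s1 s2 s3 s4 →
    s1 * s1 ≈ q1 → s2 * s2 ≈ q2 → s3 * s3 ≈ q3 → s4 * s4 ≈ q4 →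
    x3 ≉ 0# → x4 ≉ 0# → q1 ≉ 0# → q2 ≉ 0# → q3 ≉ 0# → q4 ≉ 0# → ∀ k →
    let L0 = s1 * s2 * s3 * s4
        Y  = x4 / x3
    in E (+ k) x1 x2 x3 x4 s1 s2 s3 s4 / zpow (s3 * s4) (+ k)
       ≈ Δ (x1 * x2 * Y * pow (L0 / q3) k) (x1 * x2 / Y * pow (L0 / q4) k)
           (x1 * x1 * pow q1 k) (x2 * x2 * pow q2 k)
  E-factorisation-ℕ x1 x2 x3 x4 q1 q2 q3 q4 s1 s2 s3 s4 s1²≈q1 s2²≈q2 s3²≈q3 s4²≈q4
                    x3≉0 x4≉0 q1≉0 q2≉0 q3≉0 q4≉0 k = trans
    (E-factorisation (+ k) x1 x2 x3 x4 s1 s2 s3 s4 x3≉0 x4≉0 s1≉0 s2≉0 s3≉0 s4≉0)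
    (Δ-cong (*-congˡ (pow-cong k (sym (u*r*v/p≈u*v/r (s1 * s2) s4 s3²≈q3 s3≉0))))
            (*-cong (*-congˡ (sym ([x/y]⁻¹≈y/x x4≉0 x3≉0)))
                    (pow-cong k (sym (u*r/p≈u/r (s1 * s2 * s3) s4²≈q4 s4≉0))))
            (*-congˡ (pow-cong k s1²≈q1)) (*-congˡ (pow-cong k s2²≈q2)))
    where
    s1≉0 = root≉0 s1²≈q1 q1≉0
    s2≉0 = root≉0 s2²≈q2 q2≉0
    s3≉0 = root≉0 s3²≈q3 q3≉0
    s4≉0 = root≉0 s4²≈q4 q4≉0

  E-factorisation-pred : ∀ a1 a2 a3 a4 p1 p2 p3 p4 r1 r2 r3 r4 →
    r1 * r1 ≈ p1 → r2 * r2 ≈ p2 → r3 * r3 ≈ p3 → r4 * r4 ≈ p4 →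
    a3 ≉ 0# → a4 ≉ 0# → p1 ≉ 0# → p2 ≉ 0# → p3 ≉ 0# → p4 ≉ 0# → ∀ k →
    let L = r1 * r2 * r3 * r4
        X = a4 / a3
    in E (+ k ℤ.- + 1) a1 a2 a3 a4 r1 r2 r3 r4 / zpow (r3 * r4) (+ k ℤ.- + 1)
       ≈ Δ (a1 * a2 * p3 * X / L * pow (L / p3) k) (a1 * a2 * p4 / (L * X) * pow (L / p4) k)
           (a1 * a1 / p1 * pow p1 k) (a2 * a2 / p2 * pow p2 k)
  E-factorisation-pred a1 a2 a3 a4 p1 p2 p3 p4 r1 r2 r3 r4 r1²≈p1 r2²≈p2 r3²≈p3 r4²≈p4
                       a3≉0 a4≉0 p1≉0 p2≉0 p3≉0 p4≉0 k = trans
    (E-factorisation (+ k ℤ.- + 1) a1 a2 a3 a4 r1 r2 r3 r4 a3≉0 a4≉0 r1≉0 r2≉0 r3≉0 r4≉0)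
    (sym (Δ-cong (pow-shift k (x*y≉0 L≉0 (x⁻¹≉0 p3≉0)) cancel₃
                            (u*r*v/p≈u*v/r (r1 * r2) r4 r3²≈p3 r3≉0))
                 (pow-shift k (x*y≉0 L≉0 (x⁻¹≉0 p4≉0)) cancel₄
                            (u*r/p≈u/r (r1 * r2 * r3) r4²≈p4 r4≉0))
                 (pow-shift k p1≉0 (cancel p1≉0) (sym r1²≈p1))
                 (pow-shift k p2≉0 (cancel p2≉0) (sym r2²≈p2))))
    where
    r1≉0 = root≉0 r1²≈p1 p1≉0
    r2≉0 = root≉0 r2²≈p2 p2≉0
    r3≉0 = root≉0 r3²≈p3 p3≉0
    r4≉0 = root≉0 r4²≈p4 p4≉0
    L = r1 * r2 * r3 * r4
    X = a4 / a3
    L≉0 = x*y≉0 (x*y≉0 (x*y≉0 r1≉0 r2≉0) r3≉0) r4≉0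

    units : ∀ {p} → p ≉ 0# → p * p ⁻¹ * (L * L ⁻¹) ≈ 1#
    units p≉0 = trans (*-cong (inverseʳ _ p≉0) (inverseʳ L L≉0)) (*-identityˡ 1#)

    cancel : ∀ {u p} → p ≉ 0# → u / p * p ≈ u
    cancel p≉0 = trans (*-assoc _ _ _) (x*u≈x _ (inverseˡ p≉0))

    cancel₃ : a1 * a2 * p3 * X / L * (L / p3) ≈ a1 * a2 * X
    cancel₃ = trans
      (solve 7 (λ a1 a2 p X L Li pi →
          a1 :* a2 :* p :* X :* Li :* (L :* pi) := a1 :* a2 :* X :* (p :* pi :* (L :* Li)))
        refl a1 a2 p3 X L (L ⁻¹) (p3 ⁻¹))
      (x*u≈x _ (units p3≉0))

    cancel₄ : a1 * a2 * p4 / (L * X) * (L / p4) ≈ a1 * a2 * (a3 / a4)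
    cancel₄ = begin
      a1 * a2 * p4 * (L * X) ⁻¹ * (L * p4 ⁻¹)
        ≈⟨ *-congʳ (*-congˡ (trans (⁻¹-distrib-* L≉0 (x*y≉0 a4≉0 (x⁻¹≉0 a3≉0)))
                                   (*-congˡ ([x/y]⁻¹≈y/x a4≉0 a3≉0)))) ⟩
      a1 * a2 * p4 * (L ⁻¹ * (a3 / a4)) * (L * p4 ⁻¹)
        ≈⟨ solve 7 (λ a1 a2 p Li Xi L pi →
             a1 :* a2 :* p :* (Li :* Xi) :* (L :* pi) := a1 :* a2 :* Xi :* (p :* pi :* (L :* Li)))
           refl a1 a2 p4 (L ⁻¹) (a3 / a4) L (p4 ⁻¹) ⟩
      a1 * a2 * (a3 / a4) * (p4 * p4 ⁻¹ * (L * L ⁻¹))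
        ≈⟨ x*u≈x _ (units p4≉0) ⟩
      a1 * a2 * (a3 / a4) ∎

  telescoping-step : ∀ {β U δ V} α γ P Q → β ≉ 0# → U ≉ 0# → δ ≉ 0# → V ≉ 0# →
    (U - P) * (α / (β * U)) * (γ / δ) + (V - Q) * (α * P / (β * U)) * (γ / (δ * V))
    ≈ α * γ / (β * δ) - α * P * (γ * Q) / (β * U * (δ * V))
  telescoping-step {β} {U} {δ} {V} α γ P Q β≉0 U≉0 δ≉0 V≉0 = begin
    (U - P) * (α / (β * U)) * (γ / δ) + (V - Q) * (α * P / (β * U)) * (γ / (δ * V))
      ≈⟨ +-cong (*-congʳ (*-congˡ (*-congˡ βU⁻¹)))
                (*-cong (*-congˡ (*-congˡ βU⁻¹)) (*-congˡ (⁻¹-distrib-* δ≉0 V≉0))) ⟩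
    (U - P) * (α * (β ⁻¹ * U ⁻¹)) * (γ * δ ⁻¹)
      + (V - Q) * (α * P * (β ⁻¹ * U ⁻¹)) * (γ * (δ ⁻¹ * V ⁻¹))
      ≈⟨ solve 10 (λ α γ P Q U V βi Ui δi Vi →
           let t = α :* γ :* (βi :* δi) in
             (U :- P) :* (α :* (βi :* Ui)) :* (γ :* δi)
               :+ (V :- Q) :* (α :* P :* (βi :* Ui)) :* (γ :* (δi :* Vi))
           := t :- α :* P :* (γ :* Q) :* (βi :* Ui :* (δi :* Vi))
               :+ t :* (U :* Ui :- con (+ 1)) :+ t :* P :* Ui :* (V :* Vi :- con (+ 1)))
           refl α γ P Q U V (β ⁻¹) (U ⁻¹) (δ ⁻¹) (V ⁻¹) ⟩
    t - α * P * (γ * Q) * (β ⁻¹ * U ⁻¹ * (δ ⁻¹ * V ⁻¹))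
      + t * (U * U ⁻¹ - 1#) + t * P * U ⁻¹ * (V * V ⁻¹ - 1#)
      ≈⟨ trans (x+y*[u-1]≈x _ _ (inverseʳ V V≉0)) (x+y*[u-1]≈x _ _ (inverseʳ U U≉0)) ⟩
    t - α * P * (γ * Q) * (β ⁻¹ * U ⁻¹ * (δ ⁻¹ * V ⁻¹))
      ≈⟨ sym (+-cong (*-congˡ (⁻¹-distrib-* β≉0 δ≉0))
                     (-‿cong (*-congˡ (trans (⁻¹-distrib-* (x*y≉0 β≉0 U≉0) (x*y≉0 δ≉0 V≉0))
                                             (*-cong βU⁻¹ (⁻¹-distrib-* δ≉0 V≉0)))))) ⟩
    α * γ / (β * δ) - α * P * (γ * Q) / (β * U * (δ * V)) ∎
    where
    t = α * γ * (β ⁻¹ * δ ⁻¹)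
    βU⁻¹ = ⁻¹-distrib-* β≉0 U≉0

  telescoping : ∀ {f g} (t : ℕ → Carrier) n → (∀ k → k < n → f k + g k ≈ t k - t (suc k)) →
    sumTo f n + sumTo g n ≈ t 0 - t n
  telescoping t zero    _    = trans (+-identityʳ 0#) (sym (-‿inverseʳ (t 0)))
  telescoping {f} {g} t (suc n) step = begin
    sumTo f n + f n + (sumTo g n + g n)
      ≈⟨ +-interchange _ _ _ _ ⟩
    sumTo f n + sumTo g n + (f n + g n)
      ≈⟨ +-cong (telescoping t n (λ k k<n → step k (ℕ.m<n⇒m<1+n k<n))) (step n ℕ.≤-refl) ⟩
    t 0 - t n + (t n - t (suc n))
      ≈⟨ solve 3 (λ a b c → a :- b :+ (b :- c) := a :- c) refl (t 0) (t n) (t (suc n)) ⟩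
    t 0 - t (suc n) ∎

  poch≉0-prefix : ∀ {z p m n} → m ≤′ n → poch z p n ≉ 0# → poch z p m ≉ 0#
  poch≉0-prefix ≤′-refl        pochₙ≉0 = pochₙ≉0
  poch≉0-prefix (≤′-step m≤′n) pochₙ≉0 = poch≉0-prefix m≤′n (x*y≉0⇒x≉0 pochₙ≉0)

  module _ {a₁ p₁ a₂ p₂ b₁ q₁ b₂ q₂ c₁ r₁ c₂ r₂ d₁ s₁ d₂ s₂ : Carrier} where
    A₁ A₂ B₁ B₂ C₁ C₂ D₁ D₂ : ℕ → Carrier
    A₁ = poch a₁ p₁
    A₂ = poch a₂ p₂
    B₁ = poch b₁ q₁
    B₂ = poch b₂ q₂
    C₁ = poch c₁ r₁
    C₂ = poch c₂ r₂
    D₁ = poch d₁ s₁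
    D₂ = poch d₂ s₂

    ratio : ℕ → Carrier
    ratio k = A₁ k * A₂ k * C₁ k * C₂ k / (B₁ k * B₂ k * D₁ k * D₂ k)

    termA termX : (ℕ → Carrier) → ℕ → Carrier
    termA e k = e k * (A₁ k * A₂ k / (B₁ (suc k) * B₂ (suc k))) * (C₁ k * C₂ k / (D₁ k * D₂ k))
    termX e k = e k * (A₁ (suc k) * A₂ (suc k) / (B₁ (suc k) * B₂ (suc k)))
                    * (C₁ k * C₂ k / (D₁ (suc k) * D₂ (suc k)))

    ratio-step : ∀ eA eX k →
      eA k ≈ Δ (b₁ * pow q₁ k) (b₂ * pow q₂ k) (a₁ * pow p₁ k) (a₂ * pow p₂ k) →
      eX k ≈ Δ (d₁ * pow s₁ k) (d₂ * pow s₂ k) (c₁ * pow r₁ k) (c₂ * pow r₂ k) →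
      B₁ (suc k) ≉ 0# → B₂ (suc k) ≉ 0# → D₁ (suc k) ≉ 0# → D₂ (suc k) ≉ 0# →
      termA eA k + termX eX k ≈ ratio k - ratio (suc k)
    ratio-step eA eX k eAₖ≈ eXₖ≈ B₁U₁≉0 B₂U₂≉0 D₁V₁≉0 D₂V₂≉0 = begin
      termA eA k + termX eX k
        ≈⟨ +-cong (*-congʳ (*-congʳ eAₖ≈)) (*-congʳ (*-congʳ eXₖ≈)) ⟩
      (U₁ * U₂ - P₁ * P₂) * (A₁ k * A₂ k / (B₁ k * U₁ * (B₂ k * U₂))) * (C₁ k * C₂ k / (D₁ k * D₂ k))
        + (V₁ * V₂ - Q₁ * Q₂) * (A₁ k * P₁ * (A₂ k * P₂) / (B₁ k * U₁ * (B₂ k * U₂)))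
                              * (C₁ k * C₂ k / (D₁ k * V₁ * (D₂ k * V₂)))
        ≈⟨ +-cong (*-congʳ (*-congˡ (/-cong refl (interchange _ _ _ _))))
                  (*-cong (*-congˡ (/-cong (interchange _ _ _ _) (interchange _ _ _ _)))
                          (/-cong refl (interchange _ _ _ _))) ⟩
      (U - P) * (α / (β * U)) * (γ / δ) + (V - Q) * (α * P / (β * U)) * (γ / (δ * V))
        ≈⟨ telescoping-step α γ P Q β≉0 U≉0 δ≉0 V≉0 ⟩
      α * γ / (β * δ) - α * P * (γ * Q) / (β * U * (δ * V))
        ≈⟨ sym (+-cong (/-cong (*-assoc _ _ _) (*-assoc _ _ _)) (-‿cong (/-cong regroup regroup))) ⟩
      ratio k - ratio (suc k) ∎
      where
      U₁ = 1# - b₁ * pow q₁ k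
      U₂ = 1# - b₂ * pow q₂ k
      P₁ = 1# - a₁ * pow p₁ k
      P₂ = 1# - a₂ * pow p₂ k
      V₁ = 1# - d₁ * pow s₁ k
      V₂ = 1# - d₂ * pow s₂ k
      Q₁ = 1# - c₁ * pow r₁ k
      Q₂ = 1# - c₂ * pow r₂ k
      α = A₁ k * A₂ k
      β = B₁ k * B₂ k
      γ = C₁ k * C₂ k
      δ = D₁ k * D₂ k
      U = U₁ * U₂
      P = P₁ * P₂
      V = V₁ * V₂
      Q = Q₁ * Q₂
      β≉0 = x*y≉0 (x*y≉0⇒x≉0 B₁U₁≉0) (x*y≉0⇒x≉0 B₂U₂≉0)
      U≉0 = x*y≉0 (x*y≉0⇒y≉0 B₁U₁≉0) (x*y≉0⇒y≉0 B₂U₂≉0)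
      δ≉0 = x*y≉0 (x*y≉0⇒x≉0 D₁V₁≉0) (x*y≉0⇒x≉0 D₂V₂≉0)
      V≉0 = x*y≉0 (x*y≉0⇒y≉0 D₁V₁≉0) (x*y≉0⇒y≉0 D₂V₂≉0)

      regroup : ∀ {x₁ y₁ x₂ y₂ x₃ y₃ x₄ y₄} →
        x₁ * y₁ * (x₂ * y₂) * (x₃ * y₃) * (x₄ * y₄) ≈ x₁ * x₂ * (y₁ * y₂) * (x₃ * x₄ * (y₃ * y₄))
      regroup = trans (*-assoc _ _ _) (*-cong (interchange _ _ _ _) (interchange _ _ _ _))

    pochhammer-telescoping : ∀ eA eX n →
      (∀ k → eA k ≈ Δ (b₁ * pow q₁ k) (b₂ * pow q₂ k) (a₁ * pow p₁ k) (a₂ * pow p₂ k)) →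
      (∀ k → eX k ≈ Δ (d₁ * pow s₁ k) (d₂ * pow s₂ k) (c₁ * pow r₁ k) (c₂ * pow r₂ k)) →
      B₁ n ≉ 0# → B₂ n ≉ 0# → D₁ n ≉ 0# → D₂ n ≉ 0# →
      sumTo (termA eA) n ≈ 1# - ratio n - sumTo (termX eX) n
    pochhammer-telescoping eA eX n eA≈ eX≈ B₁≉0 B₂≉0 D₁≉0 D₂≉0 = begin
      sumTo (termA eA) n
        ≈⟨ solve 2 (λ x y → x := x :+ y :- y) refl (sumTo (termA eA) n) (sumTo (termX eX) n) ⟩
      sumTo (termA eA) n + sumTo (termX eX) n - sumTo (termX eX) n
        ≈⟨ +-congʳ (telescoping ratio n step) ⟩
      ratio 0 - ratio n - sumTo (termX eX) n
        ≈⟨ +-congʳ (+-congʳ ratio₀≈1) ⟩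
      1# - ratio n - sumTo (termX eX) n ∎
      where
      ratio₀≈1 : ratio 0 ≈ 1#
      ratio₀≈1 = trans (*-cong 1⁴≈1 (trans (⁻¹-cong 1⁴≈1) 1⁻¹≈1)) (*-identityˡ 1#)
        where 1⁴≈1 = trans (*-identityʳ _) (trans (*-identityʳ _) (*-identityʳ _))

      step : ∀ k → k < n → termA eA k + termX eX k ≈ ratio k - ratio (suc k)
      step k k<n = ratio-step eA eX k (eA≈ k) (eX≈ k)
        (prefix B₁≉0) (prefix B₂≉0) (prefix D₁≉0) (prefix D₂≉0)
        where
        prefix : ∀ {z p} → poch z p n ≉ 0# → poch z p (suc k) ≉ 0#
        prefix = poch≉0-prefix (ℕ.≤⇒≤′ k<n)

theorem2p1 : ∀ {c ℓ : Level} (F : Field c ℓ) →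
  let open Field F
      open FieldOps F
  in
  (a1 a2 a3 a4 p1 p2 p3 p4 x1 x2 x3 x4 q1 q2 q3 q4 : Carrier) →
  -- fixed square roots r_i of p_i and s_i of q_i
  (r1 r2 r3 r4 s1 s2 s3 s4 : Carrier) →
  r1 * r1 ≈ p1 → r2 * r2 ≈ p2 → r3 * r3 ≈ p3 → r4 * r4 ≈ p4 →
  s1 * s1 ≈ q1 → s2 * s2 ≈ q2 → s3 * s3 ≈ q3 → s4 * s4 ≈ q4 →
  ¬ (a1 ≈ 0#) → ¬ (a2 ≈ 0#) → ¬ (a3 ≈ 0#) → ¬ (a4 ≈ 0#) →
  ¬ (p1 ≈ 0#) → ¬ (p2 ≈ 0#) → ¬ (p3 ≈ 0#) → ¬ (p4 ≈ 0#) →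
  ¬ (x1 ≈ 0#) → ¬ (x2 ≈ 0#) → ¬ (x3 ≈ 0#) → ¬ (x4 ≈ 0#) →
  ¬ (q1 ≈ 0#) → ¬ (q2 ≈ 0#) → ¬ (q3 ≈ 0#) → ¬ (q4 ≈ 0#) →
  (n : ℕ) →
  let L  = r1 * r2 * r3 * r4
      L0 = s1 * s2 * s3 * s4
      X  = a4 / a3
      Y  = x4 / x3
      A1 = λ k → poch (a1 * a1 / p1) p1 k
      A2 = λ k → poch (a2 * a2 / p2) p2 k
      B1 = λ k → poch (a1 * a2 * p3 * X / L) (L / p3) k
      B2 = λ k → poch (a1 * a2 * p4 / (L * X)) (L / p4) k
      C1 = λ k → poch (x1 * x1) q1 k
      C2 = λ k → poch (x2 * x2) q2 k
      D1 = λ k → poch (x1 * x2 * Y) (L0 / q3) k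
      D2 = λ k → poch (x1 * x2 / Y) (L0 / q4) k
  in
  -- no denominator vanishes
  ¬ (B1 n ≈ 0#) → ¬ (B2 n ≈ 0#) → ¬ (D1 n ≈ 0#) → ¬ (D2 n ≈ 0#) →
  sumTo (λ k →
      E (+ k ℤ.- + 1) a1 a2 a3 a4 r1 r2 r3 r4 / zpow (r3 * r4) (+ k ℤ.- + 1)
      * (A1 k * A2 k / (B1 (suc k) * B2 (suc k)))
      * (C1 k * C2 k / (D1 k * D2 k))) n
  ≈
  1# - A1 n * A2 n * C1 n * C2 n / (B1 n * B2 n * D1 n * D2 n)
  - sumTo (λ k →
      E (+ k) x1 x2 x3 x4 s1 s2 s3 s4 / zpow (s3 * s4) (+ k)
      * (A1 (suc k) * A2 (suc k) / (B1 (suc k) * B2 (suc k)))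
      * (C1 k * C2 k / (D1 (suc k) * D2 (suc k)))) n
theorem2p1 F a1 a2 a3 a4 p1 p2 p3 p4 x1 x2 x3 x4 q1 q2 q3 q4 r1 r2 r3 r4 s1 s2 s3 s4
  r1²≈p1 r2²≈p2 r3²≈p3 r4²≈p4 s1²≈q1 s2²≈q2 s3²≈q3 s4²≈q4
  _ _ a3≉0 a4≉0 p1≉0 p2≉0 p3≉0 p4≉0 _ _ x3≉0 x4≉0 q1≉0 q2≉0 q3≉0 q4≉0 n =
  pochhammer-telescoping _ _ n
    (E-factorisation-pred a1 a2 a3 a4 p1 p2 p3 p4 r1 r2 r3 r4 r1²≈p1 r2²≈p2 r3²≈p3 r4²≈p4
                          a3≉0 a4≉0 p1≉0 p2≉0 p3≉0 p4≉0)
    (E-factorisation-ℕ x1 x2 x3 x4 q1 q2 q3 q4 s1 s2 s3 s4 s1²≈q1 s2²≈q2 s3²≈q3 s4²≈q4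
                       x3≉0 x4≉0 q1≉0 q2≉0 q3≉0 q4≉0)
  where open FieldProperties F
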